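{- Let $G_1$ be a bridgeless cubic graph with $\tau(G_1)=k\ge 3$ and let $G_2$ be any bridgeless cubic graph. Let $e_1=u_1v_1\in E(G_1)$ and $e_2=u_2v_2\in E(G_2)$, and let $G_1\odot G_2$ be the graph obtained from $(G_1- e_1)\cup(G_2- e_2)$ by adding the edges $u_1u_2$ and $v_1v_2$. Then $\tau(G_1\odot G_2)\ge k$.
   Context: For a bridgeless cubic graph $G$, the perfect matching index $\tau(G)$ is the minimum number of perfect matchings of $G$ whose union is $E(G)$. Here $G_i-e_i$ denotes deletion of the edge $e_i$ (keeping its end vertices). -}

module Defs where

open import Data.Nat using (ℕ; module ℕ; _+_; _≤_; pred)
open import Data.Fin using (Fin; zero; suc; punchIn; splitAt; _↑ˡ_; _↑ʳ_; _≟_)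
open import Data.Fin.Properties using () 
open import Data.Product using (Σ; _×_; _,_; proj₁; proj₂; ∃-syntax)
open import Data.Sum using (_⊎_; inj₁; inj₂)
open import Data.Bool using (Bool; true; false)
open import Data.List using (List; length; filter)
open import Data.List.Base using (allFin)
open import Data.Vec using (Vec; lookup)
open import Relation.Binary.PropositionalEquality using (_≡_)
open import Relation.Nullary using (¬_)
open import Data.Bool.Properties using () renaming (_≟_ to _≟ᵇ_)
open import Relation.Nullary.Decidable using (_×-dec_)

-- A finite multigraph (parallel edges and loops a priori allowed):
-- vertices Fin n, edges Fin m, each edge has an (ordered) pair of end vertices.
record Graph : Set where
  field
    n    : ℕ
    m    : ℕ
    ends : Fin m → Fin n × Fin n
open Graph public

-- Number of edges in the edge subset S having v as first end, plus those having
-- v as second end: the degree of v in the spanning subgraph with edge set S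
-- (a loop is counted twice, as usual).
degIn : (G : Graph) → (Fin (m G) → Bool) → Fin (n G) → ℕ
degIn G S v =
  length (filter (λ e → (S e ≟ᵇ true) ×-dec (proj₁ (ends G e) ≟ v)) (allFin (m G)))
  + length (filter (λ e → (S e ≟ᵇ true) ×-dec (proj₂ (ends G e) ≟ v)) (allFin (m G)))

allEdges : (G : Graph) → Fin (m G) → Bool
allEdges G _ = true

degree : (G : Graph) → Fin (n G) → ℕ
degree G = degIn G (allEdges G)

Cubic : Graph → Set
Cubic G = ∀ v → degree G v ≡ 3

-- u and w are joined by a walk in G - e (edge e deleted, end vertices kept).
data ReachWithout (G : Graph) (e : Fin (m G)) (u : Fin (n G)) : Fin (n G) → Set where
  here : ReachWithout G e u u
  step : ∀ {x y} (f : Fin (m G)) → ¬ (f ≡ e) →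
         (ends G f ≡ (x , y) ⊎ ends G f ≡ (y , x)) →
         ReachWithout G e u x → ReachWithout G e u y

IsBridge : (G : Graph) → Fin (m G) → Set
IsBridge G e = ¬ ReachWithout G e (proj₁ (ends G e)) (proj₂ (ends G e))

Bridgeless : Graph → Set
Bridgeless G = ∀ e → ¬ IsBridge G e

IsPerfectMatching : (G : Graph) → (Fin (m G) → Bool) → Set
IsPerfectMatching G M = ∀ v → degIn G M v ≡ 1

CoveredByPMs : (G : Graph) → ℕ → Set
CoveredByPMs G k =
  Σ (Vec (Fin (m G) → Bool) k) λ Ms → ((∀ i → IsPerfectMatching G (lookup Ms i))
          × (∀ e → ∃[ i ] lookup Ms i e ≡ true))

PMIndexIs : Graph → ℕ → Set
PMIndexIs G k = CoveredByPMs G k × (∀ j → CoveredByPMs G j → k ≤ j)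

PMIndexAtLeast : Graph → ℕ → Set
PMIndexAtLeast G k = ∀ j → CoveredByPMs G j → k ≤ j

-- Edges of G other than e, indexed by Fin (pred m).
otherEdge : (m : ℕ) → Fin m → Fin (pred m) → Fin m
otherEdge (ℕ.suc m) e i = punchIn e i

-- G₁ ⊙ G₂ : (G₁ - e₁) ∪ (G₂ - e₂) plus edges u₁u₂ and v₁v₂,
-- where ends e₁ = (u₁ , v₁) and ends e₂ = (u₂ , v₂).
-- Vertices: Fin (n₁ + n₂), G₁ first. Edges: those of G₁ - e₁, then of G₂ - e₂,
-- then u₁u₂, then v₁v₂.
dot : (G₁ G₂ : Graph) → Fin (m G₁) → Fin (m G₂) → Graph
dot G₁ G₂ e₁ e₂ = record { n = n G₁ + n G₂ ; m = pred (m G₁) + (pred (m G₂) + 2) ; ends = E }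
  where
  L : Fin (n G₁) → Fin (n G₁ + n G₂)
  L v = v ↑ˡ n G₂
  R : Fin (n G₂) → Fin (n G₁ + n G₂)
  R v = n G₁ ↑ʳ v
  E : Fin (pred (m G₁) + (pred (m G₂) + 2)) → Fin (n G₁ + n G₂) × Fin (n G₁ + n G₂)
  E i with splitAt (pred (m G₁)) i
  ... | inj₁ a with ends G₁ (otherEdge (m G₁) e₁ a)
  ...   | (x , y) = L x , L y
  E i | inj₂ b with splitAt (pred (m G₂)) b
  ... | inj₁ c with ends G₂ (otherEdge (m G₂) e₂ c)
  ...   | (x , y) = R x , R y
  E i | inj₂ b | inj₂ zero = L (proj₁ (ends G₁ e₁)) , R (proj₁ (ends G₂ e₂))
  E i | inj₂ b | inj₂ (suc _) = L (proj₂ (ends G₁ e₁)) , R (proj₂ (ends G₂ e₂))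

module Submission where

-- A perfect matching M of H = G₁ ⊙ G₂ covers each vertex of G₁ once,
-- by an edge of G₁ - e₁ (two ends in G₁) or by a connecting edge u₁u₂, v₁v₂
-- (one end in G₁).  So the number of connecting edges in M has the parity of
-- |V(G₁)|, which is even because G₁ has a perfect matching: M contains both or
-- neither.  Hence "M on G₁ - e₁, plus e₁ iff u₁u₂ ∈ M" is a perfect matching of
-- G₁, and this restriction turns a cover of E(H) by j perfect matchings into a
-- cover of E(G₁) by j of them; minimality of τ(G₁) = k gives k ≤ j.

open import Defs
open import Data.Nat using (ℕ; zero; suc; _+_; _*_; _≤_; pred; s≤s)
open import Data.Nat.Properties
  using (+-*-semiring; +-comm; +-assoc; +-identityʳ; *-identityʳ; *-comm; *-distribˡ-+; *-zeroʳ; even≢odd)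
open import Data.Fin using (Fin; zero; suc; punchIn; punchOut; splitAt; _↑ˡ_; _↑ʳ_; _≟_)
open import Data.Fin.Properties
  using (↑ˡ-injective; splitAt-↑ˡ; splitAt-↑ʳ; punchOut-punchIn; punchIn-punchOut; punchInᵢ≢i)
open import Data.Product using (_×_; _,_; proj₁; proj₂; ∃-syntax)
open import Data.Bool using (Bool; true; false; _∧_)
open import Data.Bool.Properties using () renaming (_≟_ to _≟ᵇ_)
open import Data.List using (length; filter; tabulate)
open import Data.Vec using (Vec; lookup; map)
open import Data.Vec.Properties using (lookup-map)
open import Data.Empty using (⊥-elim)
open import Function using (_∘_)
open import Relation.Nullary using (¬_; Dec; does; yes; no)
open import Relation.Nullary.Decidable using (_×-dec_)
open import Relation.Binary.PropositionalEquality
open import Algebra.Properties.Semiring.Sum +-*-semiring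
  using (sum; sum-syntax; sum-cong-≗; ∑-distrib-+; ∑-comm; sum-remove; *-distribˡ-sum)

bit : Bool → ℕ
bit true  = 1
bit false = 0

𝟙 : ∀ {p} {P : Set p} → Dec P → ℕ
𝟙 d = bit (does d)

bit-∧ : ∀ b c → bit (b ∧ c) ≡ bit b * bit c
bit-∧ true  true  = refl
bit-∧ true  false = refl
bit-∧ false c     = refl

does-≟true : ∀ b → does (b ≟ᵇ true) ≡ b
does-≟true true  = refl
does-≟true false = refl

length-filter-tabulate : ∀ {n} {A : Set} {P : A → Set} (P? : ∀ x → Dec (P x)) (f : Fin n → A) →
  length (filter P? (tabulate f)) ≡ ∑[ i < n ] 𝟙 (P? (f i))
length-filter-tabulate {zero}  P? f = refl
length-filter-tabulate {suc n} P? f with does (P? (f zero))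
... | true  = cong suc (length-filter-tabulate P? (f ∘ suc))
... | false = length-filter-tabulate P? (f ∘ suc)

∑-const : ∀ n c → ∑[ i < n ] c ≡ n * c
∑-const zero    c = refl
∑-const (suc n) c = cong (c +_) (∑-const n c)

∑-indicator : ∀ {n} (x : Fin n) → ∑[ v < n ] 𝟙 (x ≟ v) ≡ 1
∑-indicator {suc n} zero    = cong suc (trans (∑-const n 0) (*-zeroʳ n))
∑-indicator {suc n} (suc x) = trans (sum-cong-≗ reindex) (∑-indicator x)
  where
  reindex : ∀ v → 𝟙 (suc x ≟ suc v) ≡ 𝟙 (x ≟ v)
  reindex v with x ≟ v
  ... | yes _ = refl
  ... | no  _ = refl

∑-scaled-indicator : ∀ {n} b (y : Fin n) → ∑[ x < n ] (b * 𝟙 (y ≟ x)) ≡ b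
∑-scaled-indicator b y =
  trans (sym (*-distribˡ-sum b (λ x → 𝟙 (y ≟ x)))) (trans (cong (b *_) (∑-indicator y)) (*-identityʳ b))

∑-↑ : ∀ a b (f : Fin (a + b) → ℕ) → sum f ≡ ∑[ i < a ] f (i ↑ˡ b) + ∑[ j < b ] f (a ↑ʳ j)
∑-↑ zero    b f = refl
∑-↑ (suc a) b f = trans (cong (f zero +_) (∑-↑ a b (f ∘ suc))) (sym (+-assoc (f zero) _ _))

incidence : ∀ {n} → Fin n × Fin n → Fin n → ℕ
incidence p v = 𝟙 (proj₁ p ≟ v) + 𝟙 (proj₂ p ≟ v)

∑-incidence : ∀ {n} (p : Fin n × Fin n) → ∑[ v < n ] incidence p v ≡ 2
∑-incidence (x , y) =
  trans (∑-distrib-+ (λ v → 𝟙 (x ≟ v)) (λ v → 𝟙 (y ≟ v))) (cong₂ _+_ (∑-indicator x) (∑-indicator y))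

degIn-as-sum : (G : Graph) (M : Fin (m G) → Bool) (v : Fin (n G)) →
  degIn G M v ≡ ∑[ e < m G ] (bit (M e) * incidence (ends G e) v)
degIn-as-sum G M v = begin
  degIn G M v
    ≡⟨ cong₂ _+_ (endCount proj₁) (endCount proj₂) ⟩
  ∑[ e < m G ] (bit (M e) * 𝟙 (proj₁ (ends G e) ≟ v)) + ∑[ e < m G ] (bit (M e) * 𝟙 (proj₂ (ends G e) ≟ v))
    ≡⟨ sym (∑-distrib-+ (λ e → bit (M e) * 𝟙 (proj₁ (ends G e) ≟ v)) (λ e → bit (M e) * 𝟙 (proj₂ (ends G e) ≟ v))) ⟩
  ∑[ e < m G ] (bit (M e) * 𝟙 (proj₁ (ends G e) ≟ v) + bit (M e) * 𝟙 (proj₂ (ends G e) ≟ v))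
    ≡⟨ sum-cong-≗ (λ e → sym (*-distribˡ-+ (bit (M e)) (𝟙 (proj₁ (ends G e) ≟ v)) (𝟙 (proj₂ (ends G e) ≟ v)))) ⟩
  ∑[ e < m G ] (bit (M e) * incidence (ends G e) v) ∎
  where
  open ≡-Reasoning
  endCount : (end : Fin (n G) × Fin (n G) → Fin (n G)) →
    length (filter (λ e → (M e ≟ᵇ true) ×-dec (end (ends G e) ≟ v)) (tabulate (λ e → e)))
      ≡ ∑[ e < m G ] (bit (M e) * 𝟙 (end (ends G e) ≟ v))
  endCount end = trans (length-filter-tabulate (λ e → (M e ≟ᵇ true) ×-dec (end (ends G e) ≟ v)) (λ e → e))
                       (sum-cong-≗ λ e → trans (bit-∧ (does (M e ≟ᵇ true)) (does (end (ends G e) ≟ v)))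
                                               (cong (λ b → bit b * 𝟙 (end (ends G e) ≟ v)) (does-≟true (M e))))

∑-weighted-incidences : ∀ {n k} (w : Fin k → ℕ) (ends′ : Fin k → Fin n × Fin n) →
  ∑[ v < n ] ∑[ e < k ] (w e * incidence (ends′ e) v) ≡ 2 * ∑[ e < k ] w e
∑-weighted-incidences {n} {k} w ends′ = begin
  ∑[ v < n ] ∑[ e < k ] (w e * incidence (ends′ e) v)  ≡⟨ ∑-comm (λ v e → w e * incidence (ends′ e) v) ⟩
  ∑[ e < k ] ∑[ v < n ] (w e * incidence (ends′ e) v)  ≡⟨ sum-cong-≗ twoEnds ⟩
  ∑[ e < k ] (2 * w e)                                ≡⟨ sym (*-distribˡ-sum 2 w) ⟩
  2 * ∑[ e < k ] w e                                 ∎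
  where
  open ≡-Reasoning
  twoEnds : ∀ e → ∑[ v < n ] (w e * incidence (ends′ e) v) ≡ 2 * w e
  twoEnds e = trans (sym (*-distribˡ-sum (w e) (incidence (ends′ e))))
                    (trans (cong (w e *_) (∑-incidence (ends′ e))) (*-comm (w e) 2))

perfectMatching⇒evenOrder : (G : Graph) (M : Fin (m G) → Bool) → IsPerfectMatching G M →
  n G ≡ 2 * ∑[ e < m G ] bit (M e)
perfectMatching⇒evenOrder G M pm = begin
  n G                                                      ≡⟨ sym (trans (∑-const (n G) 1) (*-identityʳ (n G))) ⟩
  ∑[ v < n G ] 1                                           ≡⟨ sum-cong-≗ (λ v → sym (pm v)) ⟩
  ∑[ v < n G ] degIn G M v                                 ≡⟨ sum-cong-≗ (degIn-as-sum G M) ⟩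
  ∑[ v < n G ] ∑[ e < m G ] (bit (M e) * incidence (ends G e) v) ≡⟨ ∑-weighted-incidences (λ e → bit (M e)) (ends G) ⟩
  2 * ∑[ e < m G ] bit (M e)                               ∎
  where open ≡-Reasoning

bits-of-even-sum : ∀ p q X Y → 2 * X ≡ 2 * Y + (bit p + bit q) → p ≡ q
bits-of-even-sum true  true  X Y _  = refl
bits-of-even-sum false false X Y _  = refl
bits-of-even-sum true  false X Y eq = ⊥-elim (even≢odd X Y (trans eq (+-comm (2 * Y) 1)))
bits-of-even-sum false true  X Y eq = ⊥-elim (even≢odd X Y (trans eq (+-comm (2 * Y) 1)))

𝟙-injective : ∀ {a b} (f : Fin a → Fin b) → (∀ x y → f x ≡ f y → x ≡ y) →
  ∀ x y → 𝟙 (f x ≟ f y) ≡ 𝟙 (x ≟ y)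
𝟙-injective f inj x y with x ≟ y | f x ≟ f y
... | yes _    | yes _  = refl
... | no  _    | no  _  = refl
... | yes refl | no  ne = ⊥-elim (ne refl)
... | no  ne   | yes eq = ⊥-elim (ne (inj x y eq))

𝟙-≢ : ∀ {a} {x y : Fin a} → ¬ x ≡ y → 𝟙 (x ≟ y) ≡ 0
𝟙-≢ {x = x} {y} ne with x ≟ y
... | yes eq = ⊥-elim (ne eq)
... | no  _  = refl

↑ʳ≢↑ˡ : ∀ {a b} (x : Fin b) (v : Fin a) → ¬ a ↑ʳ x ≡ v ↑ˡ b
↑ʳ≢↑ˡ {a} {b} x v eq with () ← trans (sym (splitAt-↑ʳ a b x)) (trans (cong (splitAt a) eq) (splitAt-↑ˡ a v b))

-- G₁ has edges Fin (suc m₁) (it contains e₁); G₁ - e₁ has edges punchIn e₁ a.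
module Dot {n₁ m₁ : ℕ} (ends₁ : Fin (suc m₁) → Fin n₁ × Fin n₁)
           (G₂ : Graph) (e₁ : Fin (suc m₁)) (e₂ : Fin (m G₂)) where

  G₁ : Graph
  G₁ = record { n = n₁ ; m = suc m₁ ; ends = ends₁ }

  H : Graph
  H = dot G₁ G₂ e₁ e₂

  u₁ v₁ : Fin n₁
  u₁ = proj₁ (ends₁ e₁)
  v₁ = proj₂ (ends₁ e₁)

  left : Fin n₁ → Fin (n H)
  left x = x ↑ˡ n G₂

  right : Fin (n G₂) → Fin (n H)
  right y = n₁ ↑ʳ y

  leftEdge : Fin m₁ → Fin (m H)
  leftEdge a = a ↑ˡ (pred (m G₂) + 2)

  rightEdge : Fin (pred (m G₂)) → Fin (m H)
  rightEdge c = m₁ ↑ʳ (c ↑ˡ 2)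

  uEdge vEdge : Fin (m H)
  uEdge = m₁ ↑ʳ (pred (m G₂) ↑ʳ zero)
  vEdge = m₁ ↑ʳ (pred (m G₂) ↑ʳ suc zero)

  ends-leftEdge : ∀ a → ends H (leftEdge a) ≡ (left (proj₁ (ends₁ (punchIn e₁ a))) , left (proj₂ (ends₁ (punchIn e₁ a))))
  ends-leftEdge a rewrite splitAt-↑ˡ m₁ a (pred (m G₂) + 2) = refl

  ends-rightEdge : ∀ c → ends H (rightEdge c) ≡
    (right (proj₁ (ends G₂ (otherEdge (m G₂) e₂ c))) , right (proj₂ (ends G₂ (otherEdge (m G₂) e₂ c))))
  ends-rightEdge c rewrite splitAt-↑ʳ m₁ (pred (m G₂) + 2) (c ↑ˡ 2) | splitAt-↑ˡ (pred (m G₂)) c 2 = refl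

  ends-uEdge : ends H uEdge ≡ (left u₁ , right (proj₁ (ends G₂ e₂)))
  ends-uEdge rewrite splitAt-↑ʳ m₁ (pred (m G₂) + 2) (pred (m G₂) ↑ʳ zero) | splitAt-↑ʳ (pred (m G₂)) 2 zero = refl

  ends-vEdge : ends H vEdge ≡ (left v₁ , right (proj₂ (ends G₂ e₂)))
  ends-vEdge rewrite splitAt-↑ʳ m₁ (pred (m G₂) + 2) (pred (m G₂) ↑ʳ suc zero) | splitAt-↑ʳ (pred (m G₂)) 2 (suc zero) = refl

  𝟙-left : ∀ y x → 𝟙 (left y ≟ left x) ≡ 𝟙 (y ≟ x)
  𝟙-left = 𝟙-injective left (↑ˡ-injective (n G₂))

  𝟙-right : ∀ z x → 𝟙 (right z ≟ left x) ≡ 0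
  𝟙-right z x = 𝟙-≢ (↑ʳ≢↑ˡ z x)

  incidence-leftEdge : ∀ a x → incidence (ends H (leftEdge a)) (left x) ≡ incidence (ends₁ (punchIn e₁ a)) x
  incidence-leftEdge a x rewrite ends-leftEdge a =
    cong₂ _+_ (𝟙-left (proj₁ (ends₁ (punchIn e₁ a))) x) (𝟙-left (proj₂ (ends₁ (punchIn e₁ a))) x)

  incidence-rightEdge : ∀ c x → incidence (ends H (rightEdge c)) (left x) ≡ 0
  incidence-rightEdge c x rewrite ends-rightEdge c =
    cong₂ _+_ (𝟙-right (proj₁ (ends G₂ (otherEdge (m G₂) e₂ c))) x) (𝟙-right (proj₂ (ends G₂ (otherEdge (m G₂) e₂ c))) x)

  incidence-uEdge : ∀ x → incidence (ends H uEdge) (left x) ≡ 𝟙 (u₁ ≟ x)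
  incidence-uEdge x rewrite ends-uEdge | 𝟙-left u₁ x | 𝟙-right (proj₁ (ends G₂ e₂)) x = +-identityʳ _

  incidence-vEdge : ∀ x → incidence (ends H vEdge) (left x) ≡ 𝟙 (v₁ ≟ x)
  incidence-vEdge x rewrite ends-vEdge | 𝟙-left v₁ x | 𝟙-right (proj₂ (ends G₂ e₂)) x = +-identityʳ _

  module _ (M : Fin (m H) → Bool) where

    restrict : Fin (suc m₁) → Bool
    restrict e with e₁ ≟ e
    ... | yes _  = M uEdge
    ... | no  ne = M (leftEdge (punchOut ne))

    restrict-e₁ : restrict e₁ ≡ M uEdge
    restrict-e₁ with e₁ ≟ e₁
    ... | yes _  = refl
    ... | no  ne = ⊥-elim (ne refl)

    restrict-punchIn : ∀ a → restrict (punchIn e₁ a) ≡ M (leftEdge a)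
    restrict-punchIn a with e₁ ≟ punchIn e₁ a
    ... | yes eq = ⊥-elim (punchInᵢ≢i e₁ a (sym eq))
    ... | no  ne = cong (M ∘ leftEdge) (punchOut-punchIn e₁)

    innerDeg : Fin n₁ → ℕ
    innerDeg x = ∑[ a < m₁ ] (bit (M (leftEdge a)) * incidence (ends₁ (punchIn e₁ a)) x)

    connectingDeg : Fin n₁ → ℕ
    connectingDeg x = bit (M uEdge) * 𝟙 (u₁ ≟ x) + bit (M vEdge) * 𝟙 (v₁ ≟ x)

    degIn-left : ∀ x → degIn H M (left x) ≡ innerDeg x + connectingDeg x
    degIn-left x = begin
      degIn H M (left x)                                              ≡⟨ degIn-as-sum H M (left x) ⟩
      sum w                                                           ≡⟨ ∑-↑ m₁ (pred (m G₂) + 2) w ⟩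
      sum (w ∘ leftEdge) + sum (λ j → w (m₁ ↑ʳ j))                    ≡⟨ cong (sum (w ∘ leftEdge) +_) (∑-↑ (pred (m G₂)) 2 (λ j → w (m₁ ↑ʳ j))) ⟩
      sum (w ∘ leftEdge) + (sum (w ∘ rightEdge) + (w uEdge + (w vEdge + 0)))
        ≡⟨ cong₂ _+_ (sum-cong-≗ λ a → cong (bit (M (leftEdge a)) *_) (incidence-leftEdge a x))
                     (cong₂ _+_ (sum-cong-≗ {y = λ _ → 0} λ c → trans (cong (bit (M (rightEdge c)) *_) (incidence-rightEdge c x)) (*-zeroʳ (bit (M (rightEdge c)))))
                                (cong₂ _+_ (cong (bit (M uEdge) *_) (incidence-uEdge x))
                                           (trans (+-identityʳ (w vEdge)) (cong (bit (M vEdge) *_) (incidence-vEdge x))))) ⟩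
      innerDeg x + (∑[ c < pred (m G₂) ] 0 + connectingDeg x)
        ≡⟨ cong (λ z → innerDeg x + (z + connectingDeg x)) (trans (∑-const (pred (m G₂)) 0) (*-zeroʳ (pred (m G₂)))) ⟩
      innerDeg x + connectingDeg x ∎
      where
      open ≡-Reasoning
      w : Fin (m H) → ℕ
      w e = bit (M e) * incidence (ends H e) (left x)

    degIn-restrict : ∀ x → degIn G₁ restrict x ≡ bit (M uEdge) * incidence (ends₁ e₁) x + innerDeg x
    degIn-restrict x = begin
      degIn G₁ restrict x                                         ≡⟨ degIn-as-sum G₁ restrict x ⟩
      sum w                                                       ≡⟨ sum-remove {i = e₁} w ⟩
      w e₁ + ∑[ a < m₁ ] w (punchIn e₁ a)
        ≡⟨ cong₂ _+_ (cong (λ b → bit b * incidence (ends₁ e₁) x) restrict-e₁)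
                     (sum-cong-≗ λ a → cong (λ b → bit b * incidence (ends₁ (punchIn e₁ a)) x) (restrict-punchIn a)) ⟩
      bit (M uEdge) * incidence (ends₁ e₁) x + innerDeg x         ∎
      where
      open ≡-Reasoning
      w : Fin (suc m₁) → ℕ
      w e = bit (restrict e) * incidence (ends₁ e) x

    connectingEdges-agree : IsPerfectMatching H M → ∀ X → n₁ ≡ 2 * X → M uEdge ≡ M vEdge
    connectingEdges-agree pm X n₁≡2X = bits-of-even-sum (M uEdge) (M vEdge) X innerEdges (begin
      2 * X                                                   ≡⟨ sym n₁≡2X ⟩
      n₁                                                      ≡⟨ sym (trans (∑-const n₁ 1) (*-identityʳ n₁)) ⟩
      ∑[ x < n₁ ] 1                                           ≡⟨ sum-cong-≗ (λ x → sym (trans (sym (degIn-left x)) (pm (left x)))) ⟩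
      ∑[ x < n₁ ] (innerDeg x + connectingDeg x)              ≡⟨ ∑-distrib-+ innerDeg connectingDeg ⟩
      sum innerDeg + sum connectingDeg
        ≡⟨ cong₂ _+_ (∑-weighted-incidences (λ a → bit (M (leftEdge a))) (ends₁ ∘ punchIn e₁))
                     (trans (∑-distrib-+ (λ x → bit (M uEdge) * 𝟙 (u₁ ≟ x)) (λ x → bit (M vEdge) * 𝟙 (v₁ ≟ x)))
                            (cong₂ _+_ (∑-scaled-indicator (bit (M uEdge)) u₁) (∑-scaled-indicator (bit (M vEdge)) v₁))) ⟩
      2 * innerEdges + (bit (M uEdge) + bit (M vEdge))        ∎)
      where
      open ≡-Reasoning
      innerEdges : ℕ
      innerEdges = ∑[ a < m₁ ] bit (M (leftEdge a))

    restrict-perfect : IsPerfectMatching H M → M uEdge ≡ M vEdge → IsPerfectMatching G₁ restrict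
    restrict-perfect pm agree x = begin
      degIn G₁ restrict x                                             ≡⟨ degIn-restrict x ⟩
      bit (M uEdge) * (𝟙 (u₁ ≟ x) + 𝟙 (v₁ ≟ x)) + innerDeg x
        ≡⟨ cong (_+ innerDeg x) (*-distribˡ-+ (bit (M uEdge)) (𝟙 (u₁ ≟ x)) (𝟙 (v₁ ≟ x))) ⟩
      bit (M uEdge) * 𝟙 (u₁ ≟ x) + bit (M uEdge) * 𝟙 (v₁ ≟ x) + innerDeg x
        ≡⟨ cong (λ b → bit (M uEdge) * 𝟙 (u₁ ≟ x) + bit b * 𝟙 (v₁ ≟ x) + innerDeg x) agree ⟩
      connectingDeg x + innerDeg x                                    ≡⟨ +-comm (connectingDeg x) (innerDeg x) ⟩
      innerDeg x + connectingDeg x                                    ≡⟨ sym (degIn-left x) ⟩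
      degIn H M (left x)                                              ≡⟨ pm (left x) ⟩
      1                                                               ∎
      where open ≡-Reasoning

  restrict-covers : ∀ {j} (Ms : Vec (Fin (m H) → Bool) j) → (∀ e → ∃[ i ] lookup Ms i e ≡ true) →
    ∀ e → ∃[ i ] lookup (map restrict Ms) i e ≡ true
  restrict-covers Ms covers e with e₁ ≟ e | covers uEdge
  ... | yes refl | i , uEdge∈Mᵢ =
    i , trans (cong (λ M → M e₁) (lookup-map i restrict Ms)) (trans (restrict-e₁ (lookup Ms i)) uEdge∈Mᵢ)
  restrict-covers Ms covers e | no ne | _ with covers (leftEdge (punchOut ne))
  ... | i , a∈Mᵢ = i , (begin
    lookup (map restrict Ms) i e               ≡⟨ cong (λ M → M e) (lookup-map i restrict Ms) ⟩
    restrict (lookup Ms i) e                   ≡⟨ cong (restrict (lookup Ms i)) (sym (punchIn-punchOut ne)) ⟩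
    restrict (lookup Ms i) (punchIn e₁ (punchOut ne)) ≡⟨ restrict-punchIn (lookup Ms i) (punchOut ne) ⟩
    lookup Ms i (leftEdge (punchOut ne))       ≡⟨ a∈Mᵢ ⟩
    true                                       ∎)
    where open ≡-Reasoning

  restrict-cover : ∀ M₁ → IsPerfectMatching G₁ M₁ → ∀ j → CoveredByPMs H j → CoveredByPMs G₁ j
  restrict-cover M₁ perfect₁ j (Ms , perfect , covers) = map restrict Ms , perfect′ , restrict-covers Ms covers
    where
    evenOrder : n₁ ≡ 2 * ∑[ e < suc m₁ ] bit (M₁ e)
    evenOrder = perfectMatching⇒evenOrder G₁ M₁ perfect₁
    perfect′ : ∀ i → IsPerfectMatching G₁ (lookup (map restrict Ms) i)
    perfect′ i = subst (IsPerfectMatching G₁) (sym (lookup-map i restrict Ms))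
                   (restrict-perfect (lookup Ms i) (perfect i)
                     (connectingEdges-agree (lookup Ms i) (perfect i) (∑[ e < suc m₁ ] bit (M₁ e)) evenOrder))

proposition2p2 : (G₁ G₂ : Graph) (k : ℕ) → Cubic G₁ → Bridgeless G₁ → Cubic G₂ → Bridgeless G₂ →
    3 ≤ k → PMIndexIs G₁ k → (e₁ : Fin (m G₁)) (e₂ : Fin (m G₂)) →
    PMIndexAtLeast (dot G₁ G₂ e₁ e₂) k
proposition2p2 record { m = zero } G₂ k _ _ _ _ _ _ () e₂
proposition2p2 record { m = suc _ ; ends = ends₁ } G₂ (suc k) _ _ _ _ (s≤s _)
               ((Ms₁ , perfect₁ , _) , minimal) e₁ e₂ j coverH =
  minimal j (restrict-cover (lookup Ms₁ zero) (perfect₁ zero) j coverH)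
  where open Dot ends₁ G₂ e₁ e₂ using (restrict-cover)
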